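{- Let $\phi$ be a formula and $\{\phi_i\mid i\in I\}$ a finite set of formulas of $\mathsf{PT}$ such that $\phi\bigsqcup_{i\in I}\phi_i$. If $\models\phi$, then $\models\phi_i$ for some $i\in I$.
   Context: A valuation is a function $v:\mathrm{Prop}\to\{0,1\}$ on the set $\mathrm{Prop}$ of propositional variables; a team is a set of valuations. Formulas of $\mathsf{PT}$ are given by $\phi::=p\mid\neg p\mid\bot\mid\top\mid{=}(p_1,\dots,p_k,q)\mid\phi\wedge\phi\mid\phi\otimes\phi\mid\phi\vee\phi\mid\phi\to\phi$ with $p,p_i,q\in\mathrm{Prop}$. Team semantics: $X\models p$ iff $v(p)=1$ for all $v\in X$; $X\models\neg p$ iff $v(p)=0$ for all $v\in X$; $X\models\bot$ iff $X=\emptyset$; $X\models\top$ always; $X\models{=}(\vec p,q)$ iff for all $v,v'\in X$, $v(\vec p)=v'(\vec p)$ implies $v(q)=v'(q)$; $X\models\phi\wedge\psi$ iff both; $X\models\phi\otimes\psi$ iff $X=Y\cup Z$ with $Y\models\phi$, $Z\models\psi$; $X\models\phi\vee\psi$ iff $X\models\phi$ or $X\models\psi$; $X\models\phi\to\psi$ iff every $Y\subseteq X$ with $Y\models\phi$ satisfies $Y\models\psi$. $\models\phi$ means every team satisfies $\phi$. $\phi\bigsqcup_{i\in I}\phi_i$ means: for every team $X$, ($X\models\phi_i$ implies $X\models\phi$, for every $i\in I$) and ($X\models\phi$ implies $X\models\phi_i$ for some $i\in I$). -}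

module Defs where

open import Level using (Level; Lift; lift; 0ℓ) renaming (suc to lsuc)
open import Data.Nat using (ℕ)
open import Data.Bool using (Bool; true; false)
open import Data.List using (List)
open import Data.List.Relation.Unary.All using (All)
open import Data.Product using (Σ; _×_)
open import Data.Sum using (_⊎_)
open import Data.Fin using (Fin)
open import Data.Unit using (⊤)
open import Relation.Nullary using (¬_)
open import Relation.Binary.PropositionalEquality using (_≡_)

Prop : Set
Prop = ℕ

Valuation : Set
Valuation = Prop → Bool

-- A team is a set of valuations (a predicate on valuations; arbitrary, possibly infinite).
Team : Set₁
Team = Valuation → Set

_⊆_ : Team → Team → Set
Y ⊆ X = ∀ v → Y v → X v

data Form : Set where
  var   : Prop → Form
  nvar  : Prop → Form
  bot   : Form
  top   : Form
  dep   : List Prop → Prop → Form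
  _∧ᶠ_  : Form → Form → Form
  _⊗ᶠ_  : Form → Form → Form
  _∨ᶠ_  : Form → Form → Form
  _⇒ᶠ_  : Form → Form → Form

AgreeOn : List Prop → Valuation → Valuation → Set
AgreeOn ps v w = All (λ p → v p ≡ w p) ps

_⊨_ : Team → Form → Set₁
X ⊨ var p    = Lift (lsuc 0ℓ) (∀ v → X v → v p ≡ true)
X ⊨ nvar p   = Lift (lsuc 0ℓ) (∀ v → X v → v p ≡ false)
X ⊨ bot      = Lift (lsuc 0ℓ) (∀ v → ¬ X v)
X ⊨ top      = Lift (lsuc 0ℓ) ⊤
X ⊨ dep ps q = Lift (lsuc 0ℓ) (∀ v w → X v → X w → AgreeOn ps v w → v q ≡ w q)
X ⊨ (φ ∧ᶠ ψ) = (X ⊨ φ) × (X ⊨ ψ)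
X ⊨ (φ ⊗ᶠ ψ) = Σ Team λ Y → Σ Team λ Z →
                 Lift (lsuc 0ℓ) ((∀ v → X v → Y v ⊎ Z v) × (Y ⊆ X) × (Z ⊆ X))
                 × (Y ⊨ φ) × (Z ⊨ ψ)
X ⊨ (φ ∨ᶠ ψ) = (X ⊨ φ) ⊎ (X ⊨ ψ)
X ⊨ (φ ⇒ᶠ ψ) = ∀ (Y : Team) → Y ⊆ X → Y ⊨ φ → Y ⊨ ψ

Valid : Form → Set₁
Valid φ = ∀ (X : Team) → X ⊨ φ

-- φ ⨆_{i ∈ I} φᵢ for a finite index set I = Fin n.
BigJoin : Form → (n : ℕ) → (Fin n → Form) → Set₁
BigJoin φ n φs = ∀ (X : Team) →
  ((∀ i → X ⊨ φs i → X ⊨ φ) × (X ⊨ φ → Σ (Fin n) λ i → X ⊨ φs i))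

-- Every formula of PT is downward closed. Since φ is valid it holds on the full
-- team of all valuations, so by the join property some φᵢ holds there, and
-- downward closure then gives it on every team.
module Submission where

open import Defs
open import Data.Nat using (ℕ)
open import Data.Fin using (Fin)
open import Data.Product using (Σ; _,_; proj₁; proj₂; _×_)
open import Data.Sum using (_⊎_; inj₁; inj₂; [_,_])
open import Data.Unit using (⊤; tt)
open import Level using (lift)

fullTeam : Team
fullTeam _ = ⊤

⊆-fullTeam : ∀ X → X ⊆ fullTeam
⊆-fullTeam X _ _ = tt

_∩_ : Team → Team → Team
(X ∩ Y) v = X v × Y v

∩-⊆ˡ : ∀ X Y → (X ∩ Y) ⊆ X
∩-⊆ˡ X Y _ = proj₁

∩-⊆ʳ : ∀ X Y → (X ∩ Y) ⊆ Y
∩-⊆ʳ X Y _ = proj₂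

⊨-downwardClosed : ∀ φ {X Y} → Y ⊆ X → X ⊨ φ → Y ⊨ φ
⊨-downwardClosed (var p)    Y⊆X (lift h) = lift λ v y → h v (Y⊆X v y)
⊨-downwardClosed (nvar p)   Y⊆X (lift h) = lift λ v y → h v (Y⊆X v y)
⊨-downwardClosed bot        Y⊆X (lift h) = lift λ v y → h v (Y⊆X v y)
⊨-downwardClosed top        Y⊆X h        = h
⊨-downwardClosed (dep ps q) Y⊆X (lift h) =
  lift λ v w yv yw → h v w (Y⊆X v yv) (Y⊆X w yw)
⊨-downwardClosed (φ ∧ᶠ ψ) Y⊆X (a , b) =
  ⊨-downwardClosed φ Y⊆X a , ⊨-downwardClosed ψ Y⊆X b
⊨-downwardClosed (φ ⊗ᶠ ψ) {X} {W} W⊆X (Y , Z , lift (cover , _ , _) , a , b) =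
  Y ∩ W , Z ∩ W , lift (cover′ , ∩-⊆ʳ Y W , ∩-⊆ʳ Z W) ,
  ⊨-downwardClosed φ (∩-⊆ˡ Y W) a , ⊨-downwardClosed ψ (∩-⊆ˡ Z W) b
  where
  cover′ : ∀ v → W v → (Y ∩ W) v ⊎ (Z ∩ W) v
  cover′ v w = [ (λ y → inj₁ (y , w)) , (λ z → inj₂ (z , w)) ] (cover v (W⊆X v w))
⊨-downwardClosed (φ ∨ᶠ ψ) Y⊆X (inj₁ a) = inj₁ (⊨-downwardClosed φ Y⊆X a)
⊨-downwardClosed (φ ∨ᶠ ψ) Y⊆X (inj₂ b) = inj₂ (⊨-downwardClosed ψ Y⊆X b)
⊨-downwardClosed (φ ⇒ᶠ ψ) Y⊆X h Z Z⊆Y = h Z λ v z → Y⊆X v (Z⊆Y v z)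

fullTeam⇒Valid : ∀ φ → fullTeam ⊨ φ → Valid φ
fullTeam⇒Valid φ h X = ⊨-downwardClosed φ (⊆-fullTeam X) h

theorem2p5 : (φ : Form) (n : ℕ) (φs : Fin n → Form) →
    BigJoin φ n φs → Valid φ → Σ (Fin n) (λ i → Valid (φs i))
theorem2p5 φ n φs join valid with proj₂ (join fullTeam) (valid fullTeam)
... | i , full⊨φᵢ = i , fullTeam⇒Valid (φs i) full⊨φᵢ
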